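{- Let $r\ge3$, let $P_I$ be as in the context and let $s\in\mathbb{N}\cup\{\infty\}$. If an $r$-graph $G$ is $\mathcal{F}_s$-free, then every blowup of $G$ is $\mathcal{F}_s$-free.
   Context: A blowup of an $r$-graph $G$ is obtained by replacing each vertex $v$ by a non-empty set $W_v$ of vertices (these sets pairwise disjoint) and taking as edges all $r$-sets $\{w_1,\dots,w_r\}$ with $w_k\in W_{v_k}$ for some edge $\{v_1,\dots,v_r\}\in G$ (equivalently, iteratively adding clones: new vertices with the same link as an existing vertex). Patterns: $P=(m,E,R)$ with $E$ a collection of $r$-multisets on $[m]$, $R\subseteq[m]$; $E(V_1,\dots,V_m)$ is the $r$-graph of all $r$-sets whose profile (multiplicities $|X\cap V_i|$) lies in $E$. For $P_I=\{P_i=(m_i,E_i,R_i)\}_{i\in I}$, a $P_I$-mixing construction on $V$ is edgeless, or obtained by choosing $i\in I$ and a partition $V=V_1\cup\dots\cup V_{m_i}$ with $V_j\ne V$ for $j\in R_i$, taking $E_i(V_1,\dots,V_{m_i})$ and adding for each $j\in R_i$ a $P_I$-mixing construction on $V_j$. $\mathcal{F}_\infty$ is the family of $r$-graphs contained in no $P_I$-mixing construction; for $s\in\mathbb{N}$, $\mathcal{F}_s$ consists of members of $\mathcal{F}_\infty$ with at most $s$ vertices. $\lambda_P$ is the limiting maximum edge density of $\{P\}$-mixing constructions; $P$ is minimal if deleting any index strictly decreases $\lambda_P$. Standing assumptions: $I$ finite non-empty, $P_i$ pairwise non-isomorphic, each $P_i$ minimal with $0<\lambda_{P_i}<1$. 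-}

module Defs where

open import Data.Nat using (ℕ; zero; suc; _+_; _*_; _≤_; _<_)
open import Data.Nat.Combinatorics using (_C_)
import Data.Nat as ℕ
open import Data.Bool using (Bool; true; false; T; _∧_; _∨_; if_then_else_)
open import Data.Fin using (Fin; punchIn)
import Data.Fin as F
open import Data.Fin.Subset using (Subset; inside; outside; ∣_∣; _∩_; _∈_) renaming (⊤ to full)
open import Data.Fin.Subset.Properties using (_⊆?_; _∈?_)
open import Data.Vec using (Vec; []; _∷_; lookup; tabulate; map)
open import Data.Vec.Properties using (≡-dec)
open import Data.List using (List; filter; length)
open import Data.Bool.ListAction using (any)
import Data.List as L
open import Data.List.Membership.Propositional using () renaming (_∈_ to _∈ₗ_)
open import Data.List.Relation.Unary.All using (All)
open import Data.Product using (Σ; ∃; _×_; _,_)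
open import Data.Maybe using (Maybe; just; nothing)
open import Data.Empty using (⊥)
open import Data.Unit using (⊤)
open import Function using (_∘_; _⇔_)
open import Function.Definitions using (Injective; Surjective)
open import Relation.Nullary using (¬_; Dec; yes; no)
open import Relation.Nullary.Decidable using (⌊_⌋)
open import Relation.Binary.PropositionalEquality using (_≡_; _≢_)
open import Data.Fin.Permutation using (Permutation; _⟨$⟩ʳ_; _⟨$⟩ˡ_)

record Graph (r : ℕ) : Set where
  field
    n       : ℕ
    E       : Subset n → Bool
    uniform : ∀ X → T (E X) → ∣ X ∣ ≡ r
open Graph public

img : ∀ {n m} → (Fin n → Fin m) → Subset n → Subset m
img {n} f X = tabulate λ j →
  any (λ i → (lookup X i) ∧ ⌊ f i F.≟ j ⌋) (L.allFin n)

Embeds : ∀ {r m} → Graph r → (Subset m → Bool) → Set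
Embeds {m = m} Fg E' =
  Σ (Fin (n Fg) → Fin m) λ f → Injective _≡_ _≡_ f ×
    (∀ X → T (E Fg X) → T (E' (img f X)))

_⊆G_ : ∀ {r} → Graph r → Graph r → Set
Fg ⊆G Gg = Embeds Fg (E Gg)

subsets : (n : ℕ) → List (Subset n)
subsets zero    = [] L.∷ L.[]
subsets (suc n) = L.map (outside ∷_) (subsets n) L.++ L.map (inside ∷_) (subsets n)

countTrue : ∀ {n} → (Subset n → Bool) → ℕ
countTrue {n} e = length (filter (λ X → Data.Bool._≟_ (e X) true) (subsets n))

-- Patterns  P = (m, E, R).  An r-multiset on [m] is a multiplicity
-- vector Vec ℕ m (with entries summing to r, see PatternWF).

record Pattern : Set where
  field
    m  : ℕ
    PE : List (Vec ℕ m)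
    PR : Subset m
open Pattern public

PatternWF : ℕ → Pattern → Set
PatternWF r P = All (λ e → Data.Vec.sum e ≡ r) (PE P)

-- the partition V = V₁ ∪ … ∪ Vₘ is encoded by p : Fin n → Fin m
-- (Vⱼ = V ∩ p⁻¹(j); parts may be empty)
preimage : ∀ {n m} → (Fin n → Fin m) → Fin m → Subset n
preimage p j = tabulate λ v → ⌊ p v F.≟ j ⌋

part : ∀ {n m} → Subset n → (Fin n → Fin m) → Fin m → Subset n
part V p j = V ∩ preimage p j

profile : ∀ {n m} → (Fin n → Fin m) → Subset n → Vec ℕ m
profile p X = tabulate λ j → ∣ X ∩ preimage p j ∣

-- P_I-mixing constructions on a vertex set V ⊆ Fin n, for a family
-- P : Fin k → Pattern (I = Fin k).

data Constr {k : ℕ} (P : Fin k → Pattern) {n : ℕ} : Subset n → Set where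
  edgeless : (V : Subset n) → Constr P V
  mix : (V : Subset n) (i : Fin k) (p : Fin n → Fin (m (P i)))
      → (∀ j → j ∈ PR (P i) → part V p j ≢ V)
      → ((j : Fin (m (P i))) → j ∈ PR (P i) → Constr P (part V p j))
      → Constr P V

edgeC : ∀ {k} {P : Fin k → Pattern} {n} {V : Subset n} → Constr P V → Subset n → Bool
edgeC (edgeless V) X = false
edgeC {P = P} (mix V i p _ sub) X =
  (⌊ X ⊆? V ⌋ ∧ any (λ e → ⌊ ≡-dec ℕ._≟_ e (profile p X) ⌋) (PE (P i)))
  ∨ any go (L.allFin _)
  where
  go : Fin (m (P i)) → Bool
  go j with j ∈? PR (P i)
  ... | yes j∈R = edgeC (sub j j∈R) X
  ... | no  _   = false

InMixing : ∀ {r k} → (Fin k → Pattern) → Graph r → Set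
InMixing P Fg = Σ ℕ λ N → Σ (Constr P {N} full) λ c → Embeds Fg (edgeC c)

-- s ∈ ℕ ∪ {∞}, with nothing = ∞
InFs : ∀ {r k} → (Fin k → Pattern) → Maybe ℕ → Graph r → Set
InFs P s Fg = ¬ InMixing P Fg × Bound s
  where
  Bound : Maybe ℕ → Set
  Bound nothing  = ⊤
  Bound (just s) = n Fg ≤ s

Free : ∀ {r k} → (Fin k → Pattern) → Maybe ℕ → Graph r → Set
Free {r} P s Gg = ∀ (Fg : Graph r) → InFs P s Fg → ¬ (Fg ⊆G Gg)

-- Blowups: H is a blowup of G iff there is a surjection φ from V(H)
-- to V(G) (W_v = φ⁻¹(v), non-empty) such that the edges of H are exactly
-- the r-sets X whose image φ(X) is an edge of G (φ(X) having r elements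
-- means φ is injective on X, i.e. one vertex from each class).

IsBlowup : ∀ {r} → Graph r → Graph r → Set
IsBlowup {r} Gg Hg =
  Σ (Fin (n Hg) → Fin (n Gg)) λ φ → Surjective _≡_ _≡_ φ ×
    (∀ X → T (E Hg X) ⇔ (∣ X ∣ ≡ r × T (E Gg (img φ X))))

-- Edge densities and λ.  For a single pattern P, consider {P}-mixing
-- constructions on the full vertex set Fin N; their density is
-- (#edges)/(N choose r).  Rationals are encoded as a / suc b.

single : Pattern → Fin 1 → Pattern
single P _ = P

DensLE : ℕ → Pattern → ℕ → ℕ → ℕ → Set
DensLE r P N a b = ∀ (c : Constr (single P) {N} full) →
  suc b * countTrue (edgeC c) ≤ a * (N C r)

DensGE : ℕ → Pattern → ℕ → ℕ → ℕ → Set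
DensGE r P N a b = Σ (Constr (single P) {N} full) λ c →
  a * (N C r) ≤ suc b * countTrue (edgeC c)

-- the maximum density d_N converges to λ_P (paper); hence
-- λ_P < λ_Q  iff  ∃ rationals q₁ < q₂ with eventually d^P_N ≤ q₁ and d^Q_N ≥ q₂
LamLT : ℕ → Pattern → Pattern → Set
LamLT r P Q = Σ ℕ λ a₁ → Σ ℕ λ b₁ → Σ ℕ λ a₂ → Σ ℕ λ b₂ →
  (a₁ * suc b₂ < a₂ * suc b₁) × Σ ℕ λ N₀ → ∀ N → N₀ ≤ N →
    DensLE r P N a₁ b₁ × DensGE r Q N a₂ b₂

LamPos : ℕ → Pattern → Set
LamPos r P = Σ ℕ λ a → Σ ℕ λ b → 0 < a × Σ ℕ λ N₀ → ∀ N → N₀ ≤ N → DensGE r P N a b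

LamLT1 : ℕ → Pattern → Set
LamLT1 r P = Σ ℕ λ a → Σ ℕ λ b → a < suc b × Σ ℕ λ N₀ → ∀ N → N₀ ≤ N → DensLE r P N a b

delete : (P : Pattern) → Fin (m P) → Pattern
delete record { m = zero ; PE = E ; PR = R } ()
delete record { m = suc m' ; PE = E ; PR = R } j = record
  { m  = m'
  ; PE = L.map (λ e → tabulate (λ x → lookup e (punchIn j x)))
               (filter (λ e → lookup e j ℕ.≟ 0) E)
  ; PR = tabulate (λ x → lookup R (punchIn j x))
  }

Minimal : ℕ → Pattern → Set
Minimal r P = ∀ (j : Fin (m P)) → LamLT r (delete P j) P

relabel : ∀ {a b} → Permutation a b → Vec ℕ a → Vec ℕ b
relabel σ e = tabulate λ y → lookup e (σ ⟨$⟩ˡ y)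

PatIso : Pattern → Pattern → Set
PatIso P Q = Σ (Permutation (m P) (m Q)) λ σ →
  (∀ e → e ∈ₗ PE P → relabel σ e ∈ₗ PE Q) ×
  (∀ e → e ∈ₗ PE Q → e ∈ₗ L.map (relabel σ) (PE P)) ×
  (∀ x → lookup (PR P) x ≡ lookup (PR Q) (σ ⟨$⟩ʳ x))

{-# OPTIONS --safe #-}
-- A blowup map φ : V(H) → V(G) is a homomorphism that is injective on every edge. So for F ⊆ H
-- the composite F → G maps F edge-injectively onto an induced subgraph G′ of G with at most
-- |V(F)| vertices. If G′ lay in a mixing construction c, then F would lie in a blowup of c; but
-- pulling every partition of c back along the blowup map gives again a mixing construction (the
-- profiles of edges are unchanged, as the map is injective on them). Hence G′ ∈ 𝓕_s and G′ ⊆ G,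
-- contradicting that G is 𝓕_s-free.
module Submission where

open import Defs
open import Data.Bool using (Bool; T; _∧_; _∨_)
open import Data.Bool.Properties using (T-≡; T-∧; T-∨)
open import Data.Bool.ListAction using (any)
open import Data.Empty using (⊥-elim)
open import Data.Fin using (Fin; zero; suc; _↑ˡ_; _↑ʳ_; splitAt)
open import Data.Fin.Properties using (¬Fin0; ↑ʳ-injective; splitAt-↑ˡ; splitAt-↑ʳ)
import Data.Fin.Properties as Finₚ
open import Data.Fin.Subset using (Subset; inside; outside; ∣_∣; _∩_; _∪_; ⁅_⁆; _∈_; _∉_; _⊆_) renaming (⊤ to full; ⊥ to ∅)
open import Data.Fin.Subset.Properties using (_∈?_; _⊆?_; ⊆-antisym; ∈⊤; ∉⊥; ∣⊥∣≡0; ∣⊤∣≡n; x∈⁅x⁆; x∈⁅y⁆⇒x≡y; x∈p∩q⁺; x∈p∩q⁻; p∩q⊆p; x∈p∪q⁺; x∈p∪q⁻; ∪-identityʳ; p⊆q⇒∣p∣≤∣q∣)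
open import Data.List using (allFin)
open import Data.List.Membership.Propositional using (lose) renaming (_∈_ to _∈ₗ_)
open import Data.List.Membership.Propositional.Properties using (∈-allFin)
open import Data.List.Relation.Unary.Any using (satisfied)
import Data.List.Relation.Unary.Any as Any
open import Data.List.Relation.Unary.Any.Properties using (any⁺; any⁻)
open import Data.Maybe using (Maybe; just; nothing)
open import Data.Nat using (ℕ; suc; _≤_; _+_; s≤s)
import Data.Nat as ℕ
open import Data.Nat.Properties using (≤-trans; ≤-reflexive; m≤n⇒m≤1+n; ≤⇒≯; suc-injective)
open import Data.Product using (∃; ∃₂; _×_; _,_; proj₁; proj₂)
open import Data.Sum using (_⊎_; inj₁; inj₂; [_,_]′)
import Data.Sum as Sum
open import Data.Unit using (tt)
open import Data.Vec using ([]; _∷_; here; there; lookup; tabulate)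
open import Data.Vec.Properties using (lookup∘tabulate; tabulate∘lookup; tabulate-cong; []=⇒lookup; lookup⇒[]=; ≡-dec)
open import Data.Vec.Properties.WithK using ([]=-irrelevant)
open import Function using (_∘_; id; _⇔_; mk⇔)
open import Function.Bundles using (module Equivalence)
open import Relation.Binary.Definitions using (DecidableEquality)
open import Relation.Binary.PropositionalEquality
open import Relation.Nullary using (¬_; yes; no)
open import Relation.Nullary.Decidable using (⌊_⌋; toWitness; fromWitness)

open Equivalence using (to; from)

private variable
  a b c r : ℕ

∈⇒T-lookup : ∀ {S : Subset a} {x} → x ∈ S → T (lookup S x)
∈⇒T-lookup x∈ = from T-≡ ([]=⇒lookup x∈)

T-lookup⇒∈ : ∀ (S : Subset a) {x} → T (lookup S x) → x ∈ S
T-lookup⇒∈ S {x} t = lookup⇒[]= x S (to T-≡ t)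

∈-tabulate⁺ : ∀ (f : Fin a → Bool) {x} → T (f x) → x ∈ tabulate f
∈-tabulate⁺ f {x} t = T-lookup⇒∈ (tabulate f) (subst T (sym (lookup∘tabulate f x)) t)

∈-tabulate⁻ : ∀ (f : Fin a → Bool) {x} → x ∈ tabulate f → T (f x)
∈-tabulate⁻ f {x} x∈ = subst T (lookup∘tabulate f x) (∈⇒T-lookup x∈)

∈-preimage⁺ : ∀ (p : Fin a → Fin b) {j x} → p x ≡ j → x ∈ preimage p j
∈-preimage⁺ p eq = ∈-tabulate⁺ _ (fromWitness eq)

∈-preimage⁻ : ∀ (p : Fin a → Fin b) {j x} → x ∈ preimage p j → p x ≡ j
∈-preimage⁻ p x∈ = toWitness (∈-tabulate⁻ _ x∈)

∈-img⁺ : ∀ (f : Fin a → Fin b) {X x} → x ∈ X → f x ∈ img f X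
∈-img⁺ f {x = x} x∈ =
  ∈-tabulate⁺ _ (any⁺ _ (lose (∈-allFin x) (from T-∧ (∈⇒T-lookup x∈ , fromWitness refl))))

∈-img⁻ : ∀ (f : Fin a → Fin b) X {y} → y ∈ img f X → ∃ λ x → x ∈ X × f x ≡ y
∈-img⁻ {a} f X y∈ with satisfied (any⁻ _ (allFin a) (∈-tabulate⁻ _ y∈))
... | x , t = let (x∈ , fx≡y) = to T-∧ t in x , T-lookup⇒∈ X x∈ , toWitness fx≡y

img-cong : ∀ {f g : Fin a → Fin b} → (∀ x → f x ≡ g x) → ∀ X → img f X ≡ img g X
img-cong f≗g X = ⊆-antisym (l⊆r f≗g) (l⊆r (sym ∘ f≗g))
  where
  l⊆r : ∀ {f g : Fin _ → Fin _} → (∀ x → f x ≡ g x) → img f X ⊆ img g X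
  l⊆r {f = f} {g} f≗g y∈ with ∈-img⁻ f X y∈
  ... | x , x∈ , refl = subst (_∈ img g X) (sym (f≗g x)) (∈-img⁺ g x∈)

img-∘ : ∀ (f : Fin a → Fin b) (g : Fin b → Fin c) X → img g (img f X) ≡ img (g ∘ f) X
img-∘ f g X = ⊆-antisym l⊆r r⊆l
  where
  l⊆r : img g (img f X) ⊆ img (g ∘ f) X
  l⊆r z∈ with ∈-img⁻ g _ z∈
  ... | y , y∈ , refl with ∈-img⁻ f X y∈
  ... | x , x∈ , refl = ∈-img⁺ (g ∘ f) x∈
  r⊆l : img (g ∘ f) X ⊆ img g (img f X)
  r⊆l z∈ with ∈-img⁻ (g ∘ f) X z∈
  ... | x , x∈ , refl = ∈-img⁺ g (∈-img⁺ f x∈)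

img-∩-preimage : ∀ (f : Fin a → Fin b) (p : Fin b → Fin c) j X →
  img f (X ∩ preimage (p ∘ f) j) ≡ img f X ∩ preimage p j
img-∩-preimage f p j X = ⊆-antisym l⊆r r⊆l
  where
  l⊆r : img f (X ∩ preimage (p ∘ f) j) ⊆ img f X ∩ preimage p j
  l⊆r y∈ with ∈-img⁻ f (X ∩ preimage (p ∘ f) j) y∈
  ... | x , x∈ , refl = let (x∈X , x∈pre) = x∈p∩q⁻ X _ x∈ in
    x∈p∩q⁺ (∈-img⁺ f x∈X , ∈-preimage⁺ p (∈-preimage⁻ (p ∘ f) x∈pre))
  r⊆l : img f X ∩ preimage p j ⊆ img f (X ∩ preimage (p ∘ f) j)
  r⊆l y∈ with x∈p∩q⁻ (img f X) _ y∈
  ... | y∈img , y∈pre with ∈-img⁻ f X y∈img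
  ... | x , x∈ , refl = ∈-img⁺ f (x∈p∩q⁺ (x∈ , ∈-preimage⁺ (p ∘ f) (∈-preimage⁻ p y∈pre)))

∣img-[]∣≡0 : ∀ (f : Fin 0 → Fin b) → ∣ img f [] ∣ ≡ 0
∣img-[]∣≡0 {b} f = trans (cong ∣_∣ img-[]≡∅) (∣⊥∣≡0 b)
  where
  img-[]≡∅ : img f [] ≡ ∅
  img-[]≡∅ = ⊆-antisym (λ y∈ → ⊥-elim (¬Fin0 (proj₁ (∈-img⁻ f [] y∈)))) (⊥-elim ∘ ∉⊥)

img-outside : ∀ (f : Fin (suc a) → Fin b) X → img f (outside ∷ X) ≡ img (f ∘ suc) X
img-outside f X = ⊆-antisym l⊆r r⊆l
  where
  l⊆r : img f (outside ∷ X) ⊆ img (f ∘ suc) X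
  l⊆r y∈ with ∈-img⁻ f (outside ∷ X) y∈
  ... | suc x , there x∈ , refl = ∈-img⁺ (f ∘ suc) x∈
  r⊆l : img (f ∘ suc) X ⊆ img f (outside ∷ X)
  r⊆l y∈ with ∈-img⁻ (f ∘ suc) X y∈
  ... | x , x∈ , refl = ∈-img⁺ f (there x∈)

img-inside : ∀ (f : Fin (suc a) → Fin b) X → img f (inside ∷ X) ≡ img (f ∘ suc) X ∪ ⁅ f zero ⁆
img-inside f X = ⊆-antisym l⊆r r⊆l
  where
  l⊆r : img f (inside ∷ X) ⊆ img (f ∘ suc) X ∪ ⁅ f zero ⁆
  l⊆r y∈ with ∈-img⁻ f (inside ∷ X) y∈
  ... | zero  , _        , refl = x∈p∪q⁺ (inj₂ (x∈⁅x⁆ (f zero)))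
  ... | suc x , there x∈ , refl = x∈p∪q⁺ (inj₁ (∈-img⁺ (f ∘ suc) x∈))
  r⊆l : img (f ∘ suc) X ∪ ⁅ f zero ⁆ ⊆ img f (inside ∷ X)
  r⊆l y∈ with x∈p∪q⁻ (img (f ∘ suc) X) _ y∈
  ... | inj₂ y∈⁅⁆ rewrite x∈⁅y⁆⇒x≡y _ y∈⁅⁆ = ∈-img⁺ f here
  ... | inj₁ y∈img with ∈-img⁻ (f ∘ suc) X y∈img
  ...   | x , x∈ , refl = ∈-img⁺ f (there x∈)

x∈p⇒p∪⁅x⁆⊆p : ∀ {p : Subset a} {x} → x ∈ p → p ∪ ⁅ x ⁆ ⊆ p
x∈p⇒p∪⁅x⁆⊆p {p = p} x∈p y∈ with x∈p∪q⁻ p _ y∈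
... | inj₁ y∈p = y∈p
... | inj₂ y∈⁅x⁆ rewrite x∈⁅y⁆⇒x≡y _ y∈⁅x⁆ = x∈p

x∉p⇒∣p∪⁅x⁆∣≡1+∣p∣ : ∀ (p : Subset a) {x} → x ∉ p → ∣ p ∪ ⁅ x ⁆ ∣ ≡ suc ∣ p ∣
x∉p⇒∣p∪⁅x⁆∣≡1+∣p∣ (inside  ∷ p) {zero}  x∉ = ⊥-elim (x∉ here)
x∉p⇒∣p∪⁅x⁆∣≡1+∣p∣ (outside ∷ p) {zero}  _  = cong (suc ∘ ∣_∣) (∪-identityʳ p)
x∉p⇒∣p∪⁅x⁆∣≡1+∣p∣ (inside  ∷ p) {suc x} x∉ = cong suc (x∉p⇒∣p∪⁅x⁆∣≡1+∣p∣ p (x∉ ∘ there))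
x∉p⇒∣p∪⁅x⁆∣≡1+∣p∣ (outside ∷ p) {suc x} x∉ = x∉p⇒∣p∪⁅x⁆∣≡1+∣p∣ p (x∉ ∘ there)

∣img∣≤∣X∣ : ∀ (f : Fin a → Fin b) X → ∣ img f X ∣ ≤ ∣ X ∣
∣img∣≤∣X∣ f [] = ≤-reflexive (∣img-[]∣≡0 f)
∣img∣≤∣X∣ f (outside ∷ X) rewrite img-outside f X = ∣img∣≤∣X∣ (f ∘ suc) X
∣img∣≤∣X∣ f (inside  ∷ X) rewrite img-inside f X with f zero ∈? img (f ∘ suc) X
... | yes fz∈ = m≤n⇒m≤1+n (≤-trans (p⊆q⇒∣p∣≤∣q∣ (x∈p⇒p∪⁅x⁆⊆p fz∈)) (∣img∣≤∣X∣ (f ∘ suc) X))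
... | no  fz∉ rewrite x∉p⇒∣p∪⁅x⁆∣≡1+∣p∣ _ fz∉ = s≤s (∣img∣≤∣X∣ (f ∘ suc) X)

InjectiveOn : (Fin a → Fin b) → Subset a → Set
InjectiveOn f X = ∀ {x y} → x ∈ X → y ∈ X → f x ≡ f y → x ≡ y

injectiveOn-⊆ : ∀ {f : Fin a → Fin b} {X Y} → X ⊆ Y → InjectiveOn f Y → InjectiveOn f X
injectiveOn-⊆ X⊆Y inj x∈ y∈ = inj (X⊆Y x∈) (X⊆Y y∈)

injectiveOn-∷⁻ : ∀ {f : Fin (suc a) → Fin b} {s X} → InjectiveOn f (s ∷ X) → InjectiveOn (f ∘ suc) X
injectiveOn-∷⁻ inj x∈ y∈ eq = Finₚ.suc-injective (inj (there x∈) (there y∈) eq)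

injectiveOn-outside⁺ : ∀ {f : Fin (suc a) → Fin b} {X} → InjectiveOn (f ∘ suc) X → InjectiveOn f (outside ∷ X)
injectiveOn-outside⁺ inj (there x∈) (there y∈) eq = cong suc (inj x∈ y∈ eq)

injectiveOn-inside⁺ : ∀ {f : Fin (suc a) → Fin b} {X} →
  InjectiveOn (f ∘ suc) X → f zero ∉ img (f ∘ suc) X → InjectiveOn f (inside ∷ X)
injectiveOn-inside⁺ inj fz∉ here       here       _  = refl
injectiveOn-inside⁺ {f = f} {X} inj fz∉ here       (there y∈) eq =
  ⊥-elim (fz∉ (subst (_∈ img (f ∘ suc) X) (sym eq) (∈-img⁺ (f ∘ suc) y∈)))
injectiveOn-inside⁺ {f = f} {X} inj fz∉ (there x∈) here       eq =
  ⊥-elim (fz∉ (subst (_∈ img (f ∘ suc) X) eq (∈-img⁺ (f ∘ suc) x∈)))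
injectiveOn-inside⁺ inj fz∉ (there x∈) (there y∈) eq = cong suc (inj x∈ y∈ eq)

injectiveOn-inside⁻ : ∀ {f : Fin (suc a) → Fin b} {X} → InjectiveOn f (inside ∷ X) → f zero ∉ img (f ∘ suc) X
injectiveOn-inside⁻ {f = f} {X} inj fz∈ with ∈-img⁻ (f ∘ suc) X fz∈
... | x , x∈ , eq with inj (there x∈) here eq
... | ()

injectiveOn-cong : ∀ {f g : Fin a → Fin b} {X} → (∀ x → f x ≡ g x) → InjectiveOn f X → InjectiveOn g X
injectiveOn-cong f≗g inj {x} {y} x∈ y∈ eq = inj x∈ y∈ (trans (f≗g x) (trans eq (sym (f≗g y))))

injectiveOn-∘ : ∀ {f : Fin a → Fin b} {g : Fin b → Fin c} {X} →
  InjectiveOn g (img f X) → InjectiveOn f X → InjectiveOn (g ∘ f) X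
injectiveOn-∘ {f = f} g-inj f-inj x∈ y∈ eq = f-inj x∈ y∈ (g-inj (∈-img⁺ f x∈) (∈-img⁺ f y∈) eq)

injectiveOn-img : ∀ {f : Fin a → Fin b} {g : Fin b → Fin c} {X} → InjectiveOn (g ∘ f) X → InjectiveOn g (img f X)
injectiveOn-img {f = f} {X = X} inj x∈ y∈ eq with ∈-img⁻ f X x∈ | ∈-img⁻ f X y∈
... | _ , a∈ , refl | _ , b∈ , refl = cong f (inj a∈ b∈ eq)

injectiveOn⇒∣img∣≡∣X∣ : ∀ (f : Fin a → Fin b) X → InjectiveOn f X → ∣ img f X ∣ ≡ ∣ X ∣
injectiveOn⇒∣img∣≡∣X∣ f [] _ = ∣img-[]∣≡0 f
injectiveOn⇒∣img∣≡∣X∣ f (outside ∷ X) inj rewrite img-outside f X =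
  injectiveOn⇒∣img∣≡∣X∣ (f ∘ suc) X (injectiveOn-∷⁻ inj)
injectiveOn⇒∣img∣≡∣X∣ f (inside ∷ X) inj
  rewrite img-inside f X | x∉p⇒∣p∪⁅x⁆∣≡1+∣p∣ _ (injectiveOn-inside⁻ inj) =
  cong suc (injectiveOn⇒∣img∣≡∣X∣ (f ∘ suc) X (injectiveOn-∷⁻ inj))

∣img∣≡∣X∣⇒injectiveOn : ∀ (f : Fin a → Fin b) X → ∣ img f X ∣ ≡ ∣ X ∣ → InjectiveOn f X
∣img∣≡∣X∣⇒injectiveOn f [] _ ()
∣img∣≡∣X∣⇒injectiveOn f (outside ∷ X) eq rewrite img-outside f X =
  injectiveOn-outside⁺ (∣img∣≡∣X∣⇒injectiveOn (f ∘ suc) X eq)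
∣img∣≡∣X∣⇒injectiveOn f (inside ∷ X) eq rewrite img-inside f X with f zero ∈? img (f ∘ suc) X
... | yes fz∈ = ⊥-elim (≤⇒≯ (≤-trans (p⊆q⇒∣p∣≤∣q∣ (x∈p⇒p∪⁅x⁆⊆p fz∈)) (∣img∣≤∣X∣ (f ∘ suc) X))
                            (≤-reflexive (sym eq)))
... | no  fz∉ rewrite x∉p⇒∣p∪⁅x⁆∣≡1+∣p∣ _ fz∉ =
  injectiveOn-inside⁺ (∣img∣≡∣X∣⇒injectiveOn (f ∘ suc) X (suc-injective eq)) fz∉

T-any-≟⇔∈ : ∀ {A : Set} (_≟_ : DecidableEquality A) x xs → T (any (λ y → ⌊ y ≟ x ⌋) xs) ⇔ x ∈ₗ xs
T-any-≟⇔∈ _≟_ x xs = mk⇔ (Any.map (sym ∘ toWitness) ∘ any⁻ _ xs) (any⁺ _ ∘ Any.map (fromWitness ∘ sym))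

module _ {k} {P : Fin k → Pattern} {N} (V : Subset N) (i : Fin k) (p : Fin N → Fin (m (P i)))
         (proper : ∀ j → j ∈ PR (P i) → part V p j ≢ V)
         (sub : ∀ j → j ∈ PR (P i) → Constr P (part V p j)) (X : Subset N) where

  PatternEdge : Set
  PatternEdge = X ⊆ V × profile p X ∈ₗ PE (P i)

  RecursiveEdge : Set
  RecursiveEdge = ∃₂ λ j (j∈R : j ∈ PR (P i)) → T (edgeC (sub j j∈R) X)

  private
    patternEdge? : Bool
    patternEdge? = ⌊ X ⊆? V ⌋ ∧ any (λ e → ⌊ ≡-dec ℕ._≟_ e (profile p X) ⌋) (PE (P i))

    -- edgeC inspects the parts through a local function; this gives that function a name.
    unfold : ∃ λ (edgeInPart? : Fin (m (P i)) → Bool) →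
      edgeC (mix V i p proper sub) X ≡ patternEdge? ∨ any edgeInPart? (allFin (m (P i)))
    unfold = _ , refl

    edgeInPart? : Fin (m (P i)) → Bool
    edgeInPart? = proj₁ unfold

    edgeInPart⁻ : ∀ j → T (edgeInPart? j) → ∃ λ (j∈R : j ∈ PR (P i)) → T (edgeC (sub j j∈R) X)
    edgeInPart⁻ j t with j ∈? PR (P i)
    ... | yes j∈R = j∈R , t

    edgeInPart⁺ : ∀ {j} (j∈R : j ∈ PR (P i)) → T (edgeC (sub j j∈R) X) → T (edgeInPart? j)
    edgeInPart⁺ {j} j∈R t with j ∈? PR (P i)
    ... | yes j∈R′ = subst (λ j∈R → T (edgeC (sub j j∈R) X)) ([]=-irrelevant j∈R j∈R′) t
    ... | no  j∉R  = j∉R j∈R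

    patternEdge⁻ : T patternEdge? → PatternEdge
    patternEdge⁻ t = let (X⊆V , prof∈) = to T-∧ t in
      (λ {x} → toWitness {a? = X ⊆? V} X⊆V {x}) , to (T-any-≟⇔∈ (≡-dec ℕ._≟_) _ (PE (P i))) prof∈

    patternEdge⁺ : PatternEdge → T patternEdge?
    patternEdge⁺ (X⊆V , prof∈) =
      from T-∧ (fromWitness {a? = X ⊆? V} X⊆V , from (T-any-≟⇔∈ (≡-dec ℕ._≟_) _ (PE (P i))) prof∈)

    recursiveEdge⁻ : T (any edgeInPart? (allFin (m (P i)))) → RecursiveEdge
    recursiveEdge⁻ t = let (j , tj) = satisfied (any⁻ edgeInPart? (allFin (m (P i))) t) in j , edgeInPart⁻ j tj

    recursiveEdge⁺ : RecursiveEdge → T (any edgeInPart? (allFin (m (P i))))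
    recursiveEdge⁺ (j , j∈R , t) = any⁺ edgeInPart? (lose (∈-allFin j) (edgeInPart⁺ j∈R t))

  edgeC-mix : T (edgeC (mix V i p proper sub) X) ⇔ (PatternEdge ⊎ RecursiveEdge)
  edgeC-mix = mk⇔ (Sum.map patternEdge⁻ recursiveEdge⁻ ∘ to (T-∨ {patternEdge?}))
                  (from (T-∨ {patternEdge?}) ∘ Sum.map patternEdge⁺ recursiveEdge⁺)

profile-img : ∀ (f : Fin a → Fin b) (p : Fin b → Fin c) Y → InjectiveOn f Y →
  profile p (img f Y) ≡ profile (p ∘ f) Y
profile-img f p Y inj = tabulate-cong λ j → begin
  ∣ img f Y ∩ preimage p j ∣             ≡⟨ cong ∣_∣ (img-∩-preimage f p j Y) ⟨
  ∣ img f (Y ∩ preimage (p ∘ f) j) ∣     ≡⟨ injectiveOn⇒∣img∣≡∣X∣ f _ (injectiveOn-⊆ (p∩q⊆p Y _) inj) ⟩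
  ∣ Y ∩ preimage (p ∘ f) j ∣             ∎
  where open ≡-Reasoning

pull : (Fin a → Fin b) → Subset b → Subset a
pull f A = tabulate (lookup A ∘ f)

∈-pull⁺ : ∀ (f : Fin a → Fin b) {A x} → f x ∈ A → x ∈ pull f A
∈-pull⁺ f x∈ = ∈-tabulate⁺ _ (∈⇒T-lookup x∈)

∈-pull⁻ : ∀ (f : Fin a → Fin b) A {x} → x ∈ pull f A → f x ∈ A
∈-pull⁻ f A x∈ = T-lookup⇒∈ A (∈-tabulate⁻ _ x∈)

pull-∘ : ∀ (f : Fin b → Fin c) (g : Fin a → Fin b) A → pull g (pull f A) ≡ pull (f ∘ g) A
pull-∘ f g A = tabulate-cong λ x → lookup∘tabulate (lookup A ∘ f) (g x)

pull-id : ∀ {f : Fin a → Fin a} → (∀ x → f x ≡ x) → ∀ A → pull f A ≡ A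
pull-id f≗id A = trans (tabulate-cong (cong (lookup A) ∘ f≗id)) (tabulate∘lookup A)

pull-injective : ∀ {f : Fin a → Fin b} {σ : Fin b → Fin a} → (∀ y → f (σ y) ≡ y) →
  ∀ {A B} → pull f A ≡ pull f B → A ≡ B
pull-injective {f = f} {σ} f∘σ≗id {A} {B} eq = begin
  A                  ≡⟨ pull-id f∘σ≗id A ⟨
  pull (f ∘ σ) A     ≡⟨ pull-∘ f σ A ⟨
  pull σ (pull f A)  ≡⟨ cong (pull σ) eq ⟩
  pull σ (pull f B)  ≡⟨ pull-∘ f σ B ⟩
  pull (f ∘ σ) B     ≡⟨ pull-id f∘σ≗id B ⟩
  B                  ∎
  where open ≡-Reasoning

pull-⊤ : ∀ (f : Fin a → Fin b) → pull f full ≡ full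
pull-⊤ f = ⊆-antisym (λ _ → ∈⊤) (λ _ → ∈-pull⁺ f ∈⊤)

pull-∩ : ∀ (f : Fin a → Fin b) A B → pull f (A ∩ B) ≡ pull f A ∩ pull f B
pull-∩ f A B = ⊆-antisym l⊆r r⊆l
  where
  l⊆r : pull f (A ∩ B) ⊆ pull f A ∩ pull f B
  l⊆r x∈ = let (∈A , ∈B) = x∈p∩q⁻ A B (∈-pull⁻ f _ x∈) in x∈p∩q⁺ (∈-pull⁺ f ∈A , ∈-pull⁺ f ∈B)
  r⊆l : pull f A ∩ pull f B ⊆ pull f (A ∩ B)
  r⊆l x∈ = let (∈A , ∈B) = x∈p∩q⁻ (pull f A) _ x∈ in
    ∈-pull⁺ f (x∈p∩q⁺ (∈-pull⁻ f A ∈A , ∈-pull⁻ f B ∈B))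

pull-preimage : ∀ (f : Fin a → Fin b) (p : Fin b → Fin c) j → pull f (preimage p j) ≡ preimage (p ∘ f) j
pull-preimage f p j = tabulate-cong λ x → lookup∘tabulate _ (f x)

part-pull : ∀ (f : Fin a → Fin b) V (p : Fin b → Fin c) j → part (pull f V) (p ∘ f) j ≡ pull f (part V p j)
part-pull f V p j = sym (trans (pull-∩ f V (preimage p j)) (cong (pull f V ∩_) (pull-preimage f p j)))

module _ {k} {P : Fin k → Pattern} {M N} {ψ : Fin M → Fin N} {σ : Fin N → Fin M}
         (ψ∘σ≗id : ∀ y → ψ (σ y) ≡ y) where

  pull-proper : ∀ {V i} (p : Fin N → Fin (m (P i))) → (∀ j → j ∈ PR (P i) → part V p j ≢ V) →
    ∀ j → j ∈ PR (P i) → part (pull ψ V) (p ∘ ψ) j ≢ pull ψ V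
  pull-proper {V} p proper j j∈R eq = proper j j∈R (pull-injective ψ∘σ≗id (trans (sym (part-pull ψ V p j)) eq))

  Constr-pull : ∀ {V W} → W ≡ pull ψ V → Constr P V → Constr P W
  Constr-pull refl (edgeless V) = edgeless _
  Constr-pull refl (mix V i p proper sub) =
    mix _ i (p ∘ ψ) (pull-proper p proper) (λ j j∈R → Constr-pull (part-pull ψ V p j) (sub j j∈R))

  edgeC-pull : ∀ {V W} (W≡ : W ≡ pull ψ V) (c : Constr P V) {Y} → InjectiveOn ψ Y →
    T (edgeC c (img ψ Y)) → T (edgeC (Constr-pull W≡ c) Y)
  edgeC-pull refl (edgeless V) _ ()
  edgeC-pull refl (mix V i p proper sub) {Y} inj t =
    from (edgeC-mix {P = P} _ i (p ∘ ψ) (pull-proper p proper) _ Y)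
      (Sum.map patternEdge recursiveEdge (to (edgeC-mix {P = P} V i p proper sub (img ψ Y)) t))
    where
    patternEdge : img ψ Y ⊆ V × profile p (img ψ Y) ∈ₗ PE (P i) →
                  Y ⊆ pull ψ V × profile (p ∘ ψ) Y ∈ₗ PE (P i)
    patternEdge (ψY⊆V , prof∈) =
      ∈-pull⁺ ψ ∘ ψY⊆V ∘ ∈-img⁺ ψ , subst (_∈ₗ PE (P i)) (profile-img ψ p Y inj) prof∈
    recursiveEdge : (∃₂ λ j (j∈R : j ∈ PR (P i)) → T (edgeC (sub j j∈R) (img ψ Y))) →
      ∃₂ λ j (j∈R : j ∈ PR (P i)) → T (edgeC (Constr-pull (part-pull ψ V p j) (sub j j∈R)) Y)
    recursiveEdge (j , j∈R , t′) = j , j∈R , edgeC-pull (part-pull ψ V p j) (sub j j∈R) inj t′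

record Hom (F : Graph r) (E′ : Subset b → Bool) : Set where
  constructor hom
  field
    map          : Fin (n F) → Fin b
    injective    : ∀ X → T (E F X) → InjectiveOn map X
    edge-to-edge : ∀ X → T (E F X) → T (E′ (img map X))

embeds⇒hom : ∀ {F : Graph r} {E′ : Subset b → Bool} → Embeds F E′ → Hom F E′
embeds⇒hom (f , f-inj , f-edge) = hom f (λ _ _ _ _ → f-inj) f-edge

hom-∘ : ∀ {F G : Graph r} {E′ : Subset b → Bool} → Hom F (E G) → Hom G E′ → Hom F E′
hom-∘ {E′ = E′} (hom h h-inj h-edge) (hom g g-inj g-edge) = hom (g ∘ h)
  (λ X t → injectiveOn-∘ (g-inj (img h X) (h-edge X t)) (h-inj X t))
  (λ X t → subst (T ∘ E′) (img-∘ h g X) (g-edge (img h X) (h-edge X t)))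

blowup⇒hom : ∀ {G H : Graph r} → IsBlowup G H → Hom H (E G)
blowup⇒hom {G = G} {H} (φ , _ , edge⇔) = hom φ φ-inj (λ X → proj₂ ∘ to (edge⇔ X))
  where
  φ-inj : ∀ X → T (E H X) → InjectiveOn φ X
  φ-inj X t = let (∣X∣≡r , φX-edge) = to (edge⇔ X) t in
    ∣img∣≡∣X∣⇒injectiveOn φ X (trans (uniform G (img φ X) φX-edge) (sym ∣X∣≡r))

-- F is a subgraph of the blowup of c along h; the extra copy of Fin N makes the blowup map onto,
-- so that the pulled-back partitions stay proper.
hom⇒InMixing : ∀ {k} {P : Fin k → Pattern} {F : Graph r} {N} (c : Constr P {N} full) →
  Hom F (edgeC c) → InMixing P F
hom⇒InMixing {F = F} {N} c (hom h h-inj h-edge) =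
  N + n F , Constr-pull ψ∘σ≗id full≡ c , ι , (λ {x} {y} → ↑ʳ-injective N x y) , ι-edge
  where
  ψ : Fin (N + n F) → Fin N
  ψ = [ id , h ]′ ∘ splitAt N
  σ : Fin N → Fin (N + n F)
  σ y = y ↑ˡ n F
  ι : Fin (n F) → Fin (N + n F)
  ι x = N ↑ʳ x
  ψ∘σ≗id : ∀ y → ψ (σ y) ≡ y
  ψ∘σ≗id y rewrite splitAt-↑ˡ N y (n F) = refl
  h≗ψ∘ι : ∀ x → h x ≡ ψ (ι x)
  h≗ψ∘ι x rewrite splitAt-↑ʳ N (n F) x = refl
  full≡ : full ≡ pull ψ full
  full≡ = sym (pull-⊤ ψ)
  ι-edge : ∀ X → T (E F X) → T (edgeC (Constr-pull ψ∘σ≗id full≡ c) (img ι X))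
  ι-edge X t = edgeC-pull ψ∘σ≗id full≡ c (injectiveOn-img (injectiveOn-cong h≗ψ∘ι (h-inj X t)))
    (subst (T ∘ edgeC c) (trans (img-cong h≗ψ∘ι X) (sym (img-∘ ι ψ X))) (h-edge X t))

InMixing-hom : ∀ {k} {P : Fin k → Pattern} {F G : Graph r} → Hom F (E G) → InMixing P G → InMixing P F
InMixing-hom {G = G} F→G (_ , c , G⊆c) = hom⇒InMixing c (hom-∘ {G = G} F→G (embeds⇒hom G⊆c))

enumerate : (S : Subset a) → Fin ∣ S ∣ → Fin a
enumerate (inside  ∷ S) zero    = zero
enumerate (inside  ∷ S) (suc i) = suc (enumerate S i)
enumerate (outside ∷ S) i       = suc (enumerate S i)

enumerate-injective : ∀ (S : Subset a) {i j} → enumerate S i ≡ enumerate S j → i ≡ j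
enumerate-injective (inside  ∷ S) {zero}  {zero}  _  = refl
enumerate-injective (inside  ∷ S) {suc i} {suc j} eq = cong suc (enumerate-injective S (Finₚ.suc-injective eq))
enumerate-injective (outside ∷ S)                 eq = enumerate-injective S (Finₚ.suc-injective eq)

enumerate-onto : ∀ (S : Subset a) {x} → x ∈ S → ∃ λ i → enumerate S i ≡ x
enumerate-onto (inside  ∷ S) here       = zero , refl
enumerate-onto (inside  ∷ S) (there x∈) = let (i , eq) = enumerate-onto S x∈ in suc i , cong suc eq
enumerate-onto (outside ∷ S) (there x∈) = let (i , eq) = enumerate-onto S x∈ in i , cong suc eq

induced : (G : Graph r) → Subset (n G) → Graph r
induced G S = record
  { n       = ∣ S ∣
  ; E       = E G ∘ img (enumerate S)
  ; uniform = λ Y t →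
      trans (sym (injectiveOn⇒∣img∣≡∣X∣ _ Y (λ _ _ → enumerate-injective S))) (uniform G _ t)
  }

induced-⊆G : ∀ (G : Graph r) S → induced G S ⊆G G
induced-⊆G G S = enumerate S , enumerate-injective S , λ _ t → t

hom-onto-image : ∀ {F : Graph r} (G : Graph r) (F→G : Hom F (E G)) →
  Hom F (E (induced G (img (Hom.map F→G) full)))
hom-onto-image {F = F} G (hom h h-inj h-edge) = hom h′ h′-inj h′-edge
  where
  S : Subset (n G)
  S = img h full
  onto : ∀ x → ∃ λ i → enumerate S i ≡ h x
  onto x = enumerate-onto S (∈-img⁺ h ∈⊤)
  h′ : Fin (n F) → Fin ∣ S ∣
  h′ = proj₁ ∘ onto
  h≗e∘h′ : ∀ x → h x ≡ enumerate S (h′ x)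
  h≗e∘h′ = sym ∘ proj₂ ∘ onto
  h′-inj : ∀ X → T (E F X) → InjectiveOn h′ X
  h′-inj X t x∈ y∈ eq = injectiveOn-cong h≗e∘h′ (h-inj X t) x∈ y∈ (cong (enumerate S) eq)
  h′-edge : ∀ X → T (E F X) → T (E G (img (enumerate S) (img h′ X)))
  h′-edge X t = subst (T ∘ E G) (trans (img-cong h≗e∘h′ X) (sym (img-∘ h′ (enumerate S) X))) (h-edge X t)

InFs-≤ : ∀ {k} {P : Fin k → Pattern} {F G : Graph r} s → n G ≤ n F → ¬ InMixing P G → InFs P s F → InFs P s G
InFs-≤ nothing  _   G∉ _          = G∉ , tt
InFs-≤ (just s) G≤F G∉ (_ , F≤s) = G∉ , ≤-trans G≤F F≤s

lemma3p5 : (r : ℕ) → 3 ≤ r → (k : ℕ) → 1 ≤ k → (P : Fin k → Pattern)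
    → (∀ i → PatternWF r (P i))
    → (∀ i j → i ≢ j → ¬ PatIso (P i) (P j))
    → (∀ i → Minimal r (P i))
    → (∀ i → LamPos r (P i) × LamLT1 r (P i))
    → (s : Maybe ℕ) (G H : Graph r)
    → Free P s G → IsBlowup G H → Free P s H
lemma3p5 r _ k _ P _ _ _ _ s G H G-free H-blowup F F∈Fs@(F∉mixing , _) F⊆H =
  G-free G′ (InFs-≤ s G′≤F G′∉mixing F∈Fs) (induced-⊆G G S)
  where
  F→G : Hom F (E G)
  F→G = hom-∘ {G = H} (embeds⇒hom F⊆H) (blowup⇒hom {G = G} H-blowup)
  S : Subset (n G)
  S = img (Hom.map F→G) full
  G′ : Graph r
  G′ = induced G S
  G′≤F : n G′ ≤ n F
  G′≤F = ≤-trans (∣img∣≤∣X∣ (Hom.map F→G) full) (≤-reflexive (∣⊤∣≡n (n F)))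
  G′∉mixing : ¬ InMixing P G′
  G′∉mixing = F∉mixing ∘ InMixing-hom {G = G′} (hom-onto-image G F→G)
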